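{- If a connected graph $G$ contains a pan or a diamond as an induced subgraph, then there is a DFS ordering of $G$ that is not a LexDFS ordering of $G$.
   Context: All graphs are finite and simple. For an ordering $\sigma$ of $V(G)$ write $x<_\sigma y$ if $x$ precedes $y$. $\sigma$ is a DFS ordering if whenever $a<_\sigma b<_\sigma c$, $ac\in E(G)$, $ab\notin E(G)$, there is $d$ with $a<_\sigma d<_\sigma b$ and $db\in E(G)$; it is a LexDFS ordering if under the same conditions there is $d$ with $a<_\sigma d<_\sigma b$, $db\in E(G)$ and $dc\notin E(G)$. For $k\ge3$ a $k$-pan is a $k$-cycle plus one extra vertex adjacent to exactly one cycle vertex; a pan is a $k$-pan for some $k\ge 3$. The diamond is $K_4$ minus one edge. -}

module Defs where

open import Data.Nat using (ℕ; zero; suc; _<_; _≤_; _+_; _∸_)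
open import Data.Fin using (Fin; toℕ)
open import Data.Bool using (Bool; true; false)
open import Data.Product using (Σ; ∃; ∃-syntax; _×_; _,_)
open import Data.Sum using (_⊎_)
open import Data.List using (List; []; _∷_)
open import Relation.Nullary using (¬_)
open import Relation.Binary.PropositionalEquality using (_≡_; _≢_)
open import Function.Bundles using (_↔_; _⇔_)
open import Function.Definitions using (Injective)

record Graph (n : ℕ) : Set where
  field
    adj    : Fin n → Fin n → Bool
    sym    : ∀ x y → adj x y ≡ adj y x
    irrefl : ∀ x → adj x x ≡ false
open Graph public

_∼[_]_ : {n : ℕ} → Fin n → Graph n → Fin n → Set
x ∼[ G ] y = adj G x y ≡ true

data Walk {n : ℕ} (G : Graph n) : Fin n → Fin n → Set where
  here : ∀ x → Walk G x x
  step : ∀ {x y z} → x ∼[ G ] y → Walk G y z → Walk G x z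

Connected : {n : ℕ} → Graph n → Set
Connected {n} G = ∀ (x y : Fin n) → Walk G x y

-- An ordering of V(G) is a bijection σ : V(G) ↔ Fin n giving each vertex its position.
Ordering : ℕ → Set
Ordering n = Fin n ↔ Fin n

_<[_]_ : {n : ℕ} → Fin n → Ordering n → Fin n → Set
x <[ σ ] y = toℕ (Inverse.to σ x) < toℕ (Inverse.to σ y)
  where open import Function.Bundles using (Inverse)

IsDFS : {n : ℕ} → Graph n → Ordering n → Set
IsDFS G σ = ∀ a b c → a <[ σ ] b → b <[ σ ] c → a ∼[ G ] c → ¬ (a ∼[ G ] b) →
  ∃[ d ] (a <[ σ ] d × d <[ σ ] b × d ∼[ G ] b)

IsLexDFS : {n : ℕ} → Graph n → Ordering n → Set
IsLexDFS G σ = ∀ a b c → a <[ σ ] b → b <[ σ ] c → a ∼[ G ] c → ¬ (a ∼[ G ] b) →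
  ∃[ d ] (a <[ σ ] d × d <[ σ ] b × d ∼[ G ] b × ¬ (d ∼[ G ] c))

InducedSub : {m n : ℕ} → (Fin m → Fin m → Set) → Graph n → Set
InducedSub {m} {n} H G =
  Σ (Fin m → Fin n) λ f → Injective _≡_ _≡_ f × (∀ i j → (f i ∼[ G ] f j) ⇔ H i j)

CycleAdjℕ : ℕ → ℕ → ℕ → Set
CycleAdjℕ k i j = (i < k × j < k) ×
  (suc i ≡ j ⊎ suc j ≡ i ⊎ (i ≡ 0 × suc j ≡ k) ⊎ (j ≡ 0 × suc i ≡ k))

PanAdj : (k : ℕ) → Fin (suc k) → Fin (suc k) → Set
PanAdj k x y = CycleAdjℕ k (toℕ x) (toℕ y)
             ⊎ (toℕ x ≡ k × toℕ y ≡ 0)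
             ⊎ (toℕ x ≡ 0 × toℕ y ≡ k)

DiamondAdj : Fin 4 → Fin 4 → Set
DiamondAdj x y = toℕ x ≢ toℕ y × ¬ (toℕ x ≡ 0 × toℕ y ≡ 3) × ¬ (toℕ x ≡ 3 × toℕ y ≡ 0)

module Submission where

-- A DFS may begin by walking along any path. In the pan with cycle 0, 1, …, k − 1 and
-- pendant k ∼ 0, walk 2, 3, …, k − 1, 0, k; in the diamond with 0 ≁ 3, walk 0, 1, 3.
-- The start is adjacent to c (= 1, resp. 2), which lies off the path and so comes after
-- the end b (= k, resp. 3). LexDFS would need a vertex between start and end adjacent to
-- b but not to c; it lies on the path, and the only such neighbour of b (0, resp. 1) is
-- adjacent to c. An induced embedding into G carries the walk and c along.

open import Defs hiding (sym)
open import Data.Bool using (true)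
import Data.Bool.Properties as Bool
open import Data.Empty using (⊥)
open import Data.Fin as Fin using (Fin; toℕ; fromℕ<)
open import Data.Fin.Properties
  using (toℕ-fromℕ<; toℕ-injective; toℕ<n; injective⇒≤; any?)
open import Data.List using (List; []; _∷_; _++_; [_]; length; map; applyUpTo)
open import Data.List.Properties using (++-assoc; ++-identityʳ; length-++)
open import Data.List.Membership.Propositional using (_∈_; _∉_)
open import Data.List.Membership.Propositional.Properties
  using (∈-++⁺ˡ; ∈-++⁻; ∈-map⁺; ∈-map⁻; ∈-applyUpTo⁺; ∈-applyUpTo⁻)
import Data.List.Membership.DecPropositional as DecMembership
open import Data.List.Relation.Unary.All using ([]; _∷_)
open import Data.List.Relation.Unary.Any using (here; there)
open import Data.List.Relation.Unary.Linked as Linked using (Linked; [-]; _∷_)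
import Data.List.Relation.Unary.Linked.Properties as Linkedₚ
open import Data.List.Relation.Unary.Unique.Propositional using (Unique; []; _∷_)
import Data.List.Relation.Unary.Unique.Propositional.Properties as Uniqueₚ
open import Data.Nat using (ℕ; zero; suc; _+_; _<_; _≤_; _>_; z≤n; s≤s; s≤s⁻¹)
open import Data.Nat.Properties
open import Data.Product using (Σ; ∃-syntax; _×_; _,_)
open import Data.Sum using (_⊎_; inj₁; inj₂)
open import Function.Base using (_∘_)
open import Function.Bundles using (Inverse; mk↔ₛ′; Equivalence)
open import Relation.Binary.Definitions using (DecidableEquality; Tri; tri<; tri≈; tri>)
open import Relation.Binary.PropositionalEquality
  using (_≡_; _≢_; refl; sym; trans; cong; subst; subst₂; module ≡-Reasoning)
open import Relation.Nullary using (¬_; Dec; yes; no; contradiction)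
open import Relation.Nullary.Decidable using (_×-dec_; ¬?; from-yes; from-no)
import Relation.Unary as U

∈∧∉⇒≢ : ∀ {a} {A : Set a} {x y : A} {xs} → x ∈ xs → y ∉ xs → x ≢ y
∈∧∉⇒≢ x∈ y∉ x≡y = y∉ (subst (_∈ _) x≡y x∈)

module Position {a} {A : Set a} (_≟_ : DecidableEquality A) where

  position : A → List A → ℕ
  position x []       = 0
  position x (y ∷ ys) with x ≟ y
  ... | yes _ = 0
  ... | no  _ = suc (position x ys)

  position-here : ∀ x xs → position x (x ∷ xs) ≡ 0
  position-here x xs with x ≟ x
  ... | yes _   = refl
  ... | no  x≢x = contradiction refl x≢x

  position-there : ∀ {x y} ys → x ≢ y → position x (y ∷ ys) ≡ suc (position x ys)
  position-there {x} {y} ys x≢y with x ≟ y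
  ... | yes x≡y = contradiction x≡y x≢y
  ... | no  _   = refl

  position<length : ∀ {x xs} → x ∈ xs → position x xs < length xs
  position<length {x} {y ∷ ys} x∈ with x ≟ y | x∈
  ... | yes _   | _          = s≤s z≤n
  ... | no  x≢y | here x≡y   = contradiction x≡y x≢y
  ... | no  _   | there x∈ys = s≤s (position<length x∈ys)

  position-++ˡ : ∀ {x xs} ys → x ∈ xs → position x (xs ++ ys) ≡ position x xs
  position-++ˡ {x} {y ∷ xs} ys x∈ with x ≟ y | x∈
  ... | yes _   | _          = refl
  ... | no  x≢y | here x≡y   = contradiction x≡y x≢y
  ... | no  _   | there x∈xs = cong suc (position-++ˡ ys x∈xs)

  position-++ʳ : ∀ {x} xs ys → x ∉ xs → position x (xs ++ ys) ≡ length xs + position x ys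
  position-++ʳ         []       ys _  = refl
  position-++ʳ {x} (y ∷ xs) ys x∉ with x ≟ y
  ... | yes x≡y = contradiction (here x≡y) x∉
  ... | no  _   = cong suc (position-++ʳ xs ys (x∉ ∘ there))

  position-∷ʳ : ∀ {x} xs → x ∉ xs → position x (xs ++ [ x ]) ≡ length xs
  position-∷ʳ {x} xs x∉ = begin
    position x (xs ++ [ x ])     ≡⟨ position-++ʳ xs [ x ] x∉ ⟩
    length xs + position x [ x ] ≡⟨ cong (length xs +_) (position-here x []) ⟩
    length xs + 0                ≡⟨ +-identityʳ (length xs) ⟩
    length xs                    ∎
    where open ≡-Reasoning

  position-++<length⇒∈ : ∀ {x} xs ys → position x (xs ++ ys) < length xs → x ∈ xs
  position-++<length⇒∈ {x} (y ∷ xs) ys lt with x ≟ y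
  ... | yes x≡y = here x≡y
  ... | no  _   = there (position-++<length⇒∈ xs ys (s≤s⁻¹ lt))

  position<length⇒∈ : ∀ {x} xs → position x xs < length xs → x ∈ xs
  position<length⇒∈ {x} xs lt =
    position-++<length⇒∈ xs [] (subst (_< length xs) (sym (cong (position x) (++-identityʳ xs))) lt)

  position-injective : ∀ {x y xs} → y ∈ xs → position x xs ≡ position y xs → x ≡ y
  position-injective {x} {y} {z ∷ zs} y∈ eq with x ≟ z | y ≟ z | y∈
  ... | yes x≡z | yes y≡z | _          = trans x≡z (sym y≡z)
  ... | yes _   | no  _   | _          = contradiction eq λ ()
  ... | no  _   | yes _   | _          = contradiction eq λ ()
  ... | no  _   | no  y≢z | here y≡z   = contradiction y≡z y≢z
  ... | no  _   | no  _   | there y∈zs = position-injective y∈zs (suc-injective eq)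

  lookupOr : List A → ℕ → A → A
  lookupOr []       _       d = d
  lookupOr (x ∷ xs) zero    _ = x
  lookupOr (x ∷ xs) (suc i) d = lookupOr xs i d

  lookupOr∈ : ∀ {xs} i d → i < length xs → lookupOr xs i d ∈ xs
  lookupOr∈ {x ∷ xs} zero    d _  = here refl
  lookupOr∈ {x ∷ xs} (suc i) d lt = there (lookupOr∈ i d (s≤s⁻¹ lt))

  lookupOr-position : ∀ {x xs} d → x ∈ xs → lookupOr xs (position x xs) d ≡ x
  lookupOr-position {x} {y ∷ xs} d x∈ with x ≟ y | x∈
  ... | yes x≡y | _          = sym x≡y
  ... | no  x≢y | here x≡y   = contradiction x≡y x≢y
  ... | no  _   | there x∈xs = lookupOr-position d x∈xs

  position-lookupOr : ∀ {xs} i d → Unique xs → i < length xs → position (lookupOr xs i d) xs ≡ i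
  position-lookupOr {x ∷ xs} zero    d _ _ = position-here x xs
  position-lookupOr {x ∷ xs} (suc i) d (x∉ ∷ u) lt = begin
    position (lookupOr xs i d) (x ∷ xs) ≡⟨ position-there xs lookup≢x ⟩
    suc (position (lookupOr xs i d) xs) ≡⟨ cong suc (position-lookupOr i d u (s≤s⁻¹ lt)) ⟩
    suc i                               ∎
    where
    open ≡-Reasoning
    lookup≢x : lookupOr xs i d ≢ x
    lookup≢x = ∈∧∉⇒≢ (lookupOr∈ i d (s≤s⁻¹ lt)) (Uniqueₚ.Unique[x∷xs]⇒x∉xs (x∉ ∷ u))

  lastSatisfying : ∀ {p} {P : A → Set p} → U.Decidable P → ∀ xs → Unique xs →
    (∀ {x} → x ∈ xs → ¬ P x) ⊎
    ∃[ x ] (x ∈ xs × P x × ∀ {y} → y ∈ xs → position x xs < position y xs → ¬ P y)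
  lastSatisfying         P? []       _         = inj₁ λ ()
  lastSatisfying {P = P} P? (z ∷ zs) (z∉′ ∷ u) with lastSatisfying P? zs u
  ... | inj₂ (x , x∈zs , px , later) = inj₂ (x , there x∈zs , px , later′)
    where
    z∉ : z ∉ zs
    z∉ = Uniqueₚ.Unique[x∷xs]⇒x∉xs (z∉′ ∷ u)
    later′ : ∀ {y} → y ∈ z ∷ zs → position x (z ∷ zs) < position y (z ∷ zs) → ¬ P y
    later′ (here refl)  lt = contradiction (subst (position x (z ∷ zs) <_) (position-here z zs) lt) λ ()
    later′ (there y∈zs) lt = later y∈zs (s≤s⁻¹ (subst₂ _<_
      (position-there zs (∈∧∉⇒≢ x∈zs z∉)) (position-there zs (∈∧∉⇒≢ y∈zs z∉)) lt))
  ... | inj₁ none with P? z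
  ...   | yes pz = inj₂ (z , here refl , pz , later)
    where
    later : ∀ {y} → y ∈ z ∷ zs → position z (z ∷ zs) < position y (z ∷ zs) → ¬ P y
    later (here refl)  lt = contradiction lt (<-irrefl refl)
    later (there y∈zs) _  = none y∈zs
  ...   | no ¬pz = inj₁ λ where
    (here refl)  → ¬pz
    (there y∈zs) → none y∈zs

  Linked⇒predecessor : ∀ {r} {R : A → A → Set r} {xs} → Unique xs → Linked R xs →
    ∀ {y} → y ∈ xs → 0 < position y xs → ∃[ x ] (R x y × suc (position x xs) ≡ position y xs)
  Linked⇒predecessor {xs = x ∷ xs} _ _ (here refl) pos = contradiction (sym (position-here x xs)) (<⇒≢ pos)
  Linked⇒predecessor {xs = x ∷ y ∷ ys} u@(_ ∷ u′) (Rxy ∷ l) {b} (there b∈) _ with b ≟ y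
  ... | yes refl = x , Rxy , (begin
    suc (position x (x ∷ y ∷ ys)) ≡⟨ cong suc (position-here x (y ∷ ys)) ⟩
    1                             ≡⟨ cong suc (sym (position-here y ys)) ⟩
    suc (position y (y ∷ ys))     ≡⟨ sym (position-there (y ∷ ys) (∈∧∉⇒≢ (here refl) x∉)) ⟩
    position y (x ∷ y ∷ ys)       ∎)
    where
    open ≡-Reasoning
    x∉ : x ∉ y ∷ ys
    x∉ = Uniqueₚ.Unique[x∷xs]⇒x∉xs u
  ... | no b≢y with Linked⇒predecessor u′ l b∈ (subst (0 <_) (sym (position-there ys b≢y)) (s≤s z≤n))
  ...   | v , Rvb , v-before-b = v , Rvb , (begin
    suc (position v (x ∷ y ∷ ys))     ≡⟨ cong suc (position-there (y ∷ ys) (∈∧∉⇒≢ v∈ x∉)) ⟩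
    suc (suc (position v (y ∷ ys)))   ≡⟨ cong suc v-before-b ⟩
    suc (position b (y ∷ ys))         ≡⟨ sym (position-there (y ∷ ys) (∈∧∉⇒≢ b∈ x∉)) ⟩
    position b (x ∷ y ∷ ys)           ∎)
    where
    open ≡-Reasoning
    x∉ : x ∉ y ∷ ys
    x∉ = Uniqueₚ.Unique[x∷xs]⇒x∉xs u
    v∈ : v ∈ y ∷ ys
    v∈ = position<length⇒∈ (y ∷ ys)
      (<-trans (subst (position v (y ∷ ys) <_) v-before-b (n<1+n _)) (position<length b∈))

Unique-∷ʳ : ∀ {a} {A : Set a} {x : A} {xs} → Unique xs → x ∉ xs → Unique (xs ++ [ x ])
Unique-∷ʳ u x∉ = Uniqueₚ.++⁺ u ([] ∷ []) λ where (x∈ , here refl) → x∉ x∈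

rank : ∀ {n} → Ordering n → Fin n → ℕ
rank σ x = toℕ (Inverse.to σ x)

module Enumeration {n : ℕ} where
  open Position (Fin._≟_ {n})

  Unique⇒length≤ : {F : List (Fin n)} → Unique F → length F ≤ n
  Unique⇒length≤ {[]}        _ = z≤n
  Unique⇒length≤ {F@(x ∷ _)} u = injective⇒≤ {f = λ i → lookupOr F (toℕ i) x} λ {i} {j} eq →
    toℕ-injective (begin
      toℕ i                             ≡⟨ sym (position-lookupOr (toℕ i) x u (toℕ<n i)) ⟩
      position (lookupOr F (toℕ i) x) F ≡⟨ cong (λ v → position v F) eq ⟩
      position (lookupOr F (toℕ j) x) F ≡⟨ position-lookupOr (toℕ j) x u (toℕ<n j) ⟩
      toℕ j                             ∎)
    where open ≡-Reasoning

  enumeration⇒length≥ : {F : List (Fin n)} → (∀ x → x ∈ F) → n ≤ length F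
  enumeration⇒length≥ {F} all = injective⇒≤ {f = λ x → fromℕ< (position<length (all x))} λ {x} {y} eq →
    position-injective (all y) (begin
      position x F                          ≡⟨ sym (toℕ-fromℕ< _) ⟩
      toℕ (fromℕ< (position<length (all x))) ≡⟨ cong toℕ eq ⟩
      toℕ (fromℕ< (position<length (all y))) ≡⟨ toℕ-fromℕ< _ ⟩
      position y F                          ∎)
    where open ≡-Reasoning

  enumeration⇒ordering : {F : List (Fin n)} → Unique F → (∀ x → x ∈ F) →
    Σ (Ordering n) λ σ → ∀ x → rank σ x ≡ position x F
  enumeration⇒ordering {F} u all = mk↔ₛ′ to from to∘from from∘to , λ x → toℕ-fromℕ< (bound x)
    where
    bound : ∀ x → position x F < n
    bound x = <-≤-trans (position<length (all x)) (Unique⇒length≤ u)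
    to : Fin n → Fin n
    to x = fromℕ< (bound x)
    from : Fin n → Fin n
    from i = lookupOr F (toℕ i) i
    to∘from : ∀ i → to (from i) ≡ i
    to∘from i = toℕ-injective (trans (toℕ-fromℕ< _)
      (position-lookupOr (toℕ i) i u (<-≤-trans (toℕ<n i) (enumeration⇒length≥ all))))
    from∘to : ∀ x → from (to x) ≡ x
    from∘to x = trans (cong (λ j → lookupOr F j (to x)) (toℕ-fromℕ< (bound x)))
      (lookupOr-position (to x) (all x))

record ObstructingPath {V : Set} (_∼_ : V → V → Set) : Set where
  field
    a b c           : V
    path            : List V
    unique          : Unique (a ∷ path)
    linked          : Linked _∼_ (a ∷ path)
    b∈path          : b ∈ path
    c∉path          : c ∉ a ∷ path
    a∼c             : a ∼ c
    a≁b             : ¬ a ∼ b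
    ∼b⇒∼c           : ∀ {d} → d ∈ path → d ∼ b → d ∼ c

ObstructingPath-map : ∀ {m n} {H : Fin m → Fin m → Set} {G : Graph n} →
  InducedSub H G → ObstructingPath H → ObstructingPath (λ x y → x ∼[ G ] y)
ObstructingPath-map {H = H} {G} (f , f-injective , f-induced) O = record
  { a      = f a
  ; b      = f b
  ; c      = f c
  ; path   = map f path
  ; unique = Uniqueₚ.map⁺ f-injective unique
  ; linked = Linkedₚ.map⁺ (Linked.map (λ {x} {y} → Equivalence.from (f-induced x y)) linked)
  ; b∈path = ∈-map⁺ f b∈path
  ; c∉path = λ fc∈ → let x , x∈ , fc≡fx = ∈-map⁻ f fc∈ in
      c∉path (subst (_∈ a ∷ path) (sym (f-injective fc≡fx)) x∈)
  ; a∼c    = from a∼c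
  ; a≁b    = a≁b ∘ to
  ; ∼b⇒∼c  = λ d∈ d∼b → let x , x∈ , d≡fx = ∈-map⁻ f d∈ in
      subst (_∼[ G ] f c) (sym d≡fx) (from (∼b⇒∼c x∈ (to (subst (_∼[ G ] f b) d≡fx d∼b))))
  }
  where
  open ObstructingPath O
  to : ∀ {x y} → f x ∼[ G ] f y → H x y
  to = Equivalence.to (f-induced _ _)
  from : ∀ {x y} → H x y → f x ∼[ G ] f y
  from = Equivalence.from (f-induced _ _)

module DepthFirstSearch {n : ℕ} (G : Graph n) where
  open Position (Fin._≟_ {n})
  open Enumeration {n}
  open DecMembership (Fin._≟_ {n}) using (_∈?_)

  _∼_ : Fin n → Fin n → Set
  x ∼ y = x ∼[ G ] y

  Closed : List (Fin n) → Fin n → Set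
  Closed F w = ∀ {z} → w ∼ z → z ∈ F

  -- u is the vertex from which the search discovered b: every vertex visited
  -- strictly between u and b had no unvisited neighbour left when b was reached.
  DepthFirst : List (Fin n) → Set
  DepthFirst F = ∀ {b} → b ∈ F → 0 < position b F →
    ∃[ u ] (u ∼ b × position u F < position b F ×
      (∀ {w z} → position u F < position w F → position w F < position b F → w ∼ z →
         position z F < position b F))

  DepthFirst⇒dfs : ∀ {F} → DepthFirst F → ∀ {a b c} → b ∈ F →
    position a F < position b F → position b F < position c F → a ∼ c → ¬ a ∼ b →
    ∃[ d ] (position a F < position d F × position d F < position b F × d ∼ b)
  DepthFirst⇒dfs {F} df {a} {b} b∈ a<b b<c a∼c a≁b with df b∈ (≤-<-trans z≤n a<b)
  ... | u , u∼b , u<b , finished with <-cmp (position u F) (position a F)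
  ...   | tri< u<a _ _ = contradiction (finished u<a a<b a∼c) (<-asym b<c)
  ...   | tri> _ _ a<u = u , a<u , u<b , u∼b
  ...   | tri≈ _ u≡a _ = contradiction (subst (_∼ b) (sym a≡u) u∼b) a≁b
    where
    a≡u : a ≡ u
    a≡u = position-injective (position<length⇒∈ F (<-trans u<b (position<length b∈))) (sym u≡a)

  DepthFirst⇒IsDFS : ∀ {F} (σ : Ordering n) → (∀ x → rank σ x ≡ position x F) → (∀ x → x ∈ F) →
    DepthFirst F → IsDFS G σ
  DepthFirst⇒IsDFS {F} σ rank≡ all df a b c a<b b<c a∼c a≁b =
    let d , a<d , d<b , d∼b = DepthFirst⇒dfs df (all b) (toPosition a<b) (toPosition b<c) a∼c a≁b
    in  d , toRank a<d , toRank d<b , d∼b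
    where
    toPosition : ∀ {x y} → x <[ σ ] y → position x F < position y F
    toPosition = subst₂ _<_ (rank≡ _) (rank≡ _)
    toRank : ∀ {x y} → position x F < position y F → x <[ σ ] y
    toRank = subst₂ _<_ (sym (rank≡ _)) (sym (rank≡ _))

  Linked⇒DepthFirst : ∀ {P} → Unique P → Linked _∼_ P → DepthFirst P
  Linked⇒DepthFirst {P} u l b∈ pos with Linked⇒predecessor u l b∈ pos
  ... | x , x∼b , x+1≡b = x , x∼b , subst (position x P <_) x+1≡b (n<1+n _) ,
    λ {w} x<w w<b _ → contradiction (s≤s⁻¹ (subst (position w P <_) (sym x+1≡b) w<b)) (<⇒≱ x<w)

  module _ {F : List (Fin n)} {y : Fin n} (y∉ : y ∉ F) where
    private
      position′ : Fin n → ℕ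
      position′ x = position x (F ++ [ y ])
      old : ∀ {x} → x ∈ F → position′ x ≡ position x F
      old = position-++ˡ [ y ]
      new : ∀ {x} → x ∈ F → position x F < length F → position′ x < position′ y
      new x∈ = subst₂ _<_ (sym (old x∈)) (sym (position-∷ʳ F y∉))

    DepthFirst-∷ʳ : ∀ {u} → DepthFirst F → u ∈ F → u ∼ y →
      (∀ {w} → w ∈ F → position u F < position w F → Closed F w) → DepthFirst (F ++ [ y ])
    DepthFirst-∷ʳ {u} df u∈ u∼y closed {b} b∈ pos with ∈-++⁻ F b∈
    ... | inj₂ (here refl) = u , u∼y , new u∈ (position<length u∈) , finished
      where
      finished : ∀ {w z} → position′ u < position′ w → position′ w < position′ y → w ∼ z →
        position′ z < position′ y
      finished {w} {z} u<w w<y w∼z = new z∈ (position<length z∈)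
        where
        w∈ : w ∈ F
        w∈ = position-++<length⇒∈ F [ y ] (subst (position′ w <_) (position-∷ʳ F y∉) w<y)
        z∈ : z ∈ F
        z∈ = closed w∈ (subst₂ _<_ (old u∈) (old w∈) u<w) w∼z
    ... | inj₁ b∈F with df b∈F (subst (0 <_) (old b∈F) pos)
    ...   | v , v∼b , v<b , finished = v , v∼b , subst₂ _<_ (sym (old v∈)) (sym (old b∈F)) v<b , finished′
      where
      before-b⇒∈ : ∀ {x} → position x F < position b F → x ∈ F
      before-b⇒∈ lt = position<length⇒∈ F (<-trans lt (position<length b∈F))
      v∈ : v ∈ F
      v∈ = before-b⇒∈ v<b
      finished′ : ∀ {w z} → position′ v < position′ w → position′ w < position′ b → w ∼ z →
        position′ z < position′ b
      finished′ {w} {z} v<w w<b w∼z = subst₂ _<_ (sym (old z∈)) (sym (old b∈F)) z<b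
        where
        w∈ : w ∈ F
        w∈ = position-++<length⇒∈ F [ y ]
          (<-trans w<b (subst (_< length F) (sym (old b∈F)) (position<length b∈F)))
        z<b : position z F < position b F
        z<b = finished (subst₂ _<_ (old v∈) (old w∈) v<w) (subst₂ _<_ (old w∈) (old b∈F) w<b) w∼z
        z∈ : z ∈ F
        z∈ = before-b⇒∈ z<b

  Open : List (Fin n) → Fin n → Set
  Open F w = ∃[ z ] (w ∼ z × z ∉ F)

  open? : ∀ F → U.Decidable (Open F)
  open? F w = any? λ z → (adj G w z Bool.≟ true) ×-dec ¬? (z ∈? F)

  ¬Open⇒Closed : ∀ {F w} → ¬ Open F w → Closed F w
  ¬Open⇒Closed {F} ¬open {z} w∼z with z ∈? F
  ... | yes z∈ = z∈
  ... | no  z∉ = contradiction (_ , w∼z , z∉) ¬open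

  Closed⇒enumeration : Connected G → ∀ {F v} → v ∈ F → (∀ {w} → w ∈ F → Closed F w) →
    ∀ x → x ∈ F
  Closed⇒enumeration conn {F} {v} v∈ closed x = reach (conn v x) v∈
    where
    reach : ∀ {y z} → Walk G y z → y ∈ F → z ∈ F
    reach (here _)         y∈ = y∈
    reach (step y∼y′ walk) y∈ = reach walk (closed y∈ y∼y′)

  Completion : List (Fin n) → Set
  Completion F = ∃[ Q ] (Unique (F ++ Q) × DepthFirst (F ++ Q) × (∀ x → x ∈ F ++ Q))

  Completion-∷ʳ : ∀ {F y} → Completion (F ++ [ y ]) → Completion F
  Completion-∷ʳ {F} {y} (Q , u , df , all) =
    y ∷ Q , subst Unique F++yQ u , subst DepthFirst F++yQ df , λ x → subst (x ∈_) F++yQ (all x)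
    where
    F++yQ : (F ++ [ y ]) ++ Q ≡ F ++ y ∷ Q
    F++yQ = ++-assoc F [ y ] Q

  -- Each round appends a fresh neighbour of the last vertex that still has one;
  -- k bounds the number of rounds left.
  complete : Connected G → ∀ k {F v} → n ≤ length F + k → Unique F → DepthFirst F → v ∈ F →
    Completion F
  complete conn k {F} bound u df v∈ with lastSatisfying (open? F) F u | k
  ... | inj₁ allClosed | _ =
    [] , subst Unique F≡F++[] u , subst DepthFirst F≡F++[] df ,
    λ x → subst (x ∈_) F≡F++[] (Closed⇒enumeration conn v∈ (¬Open⇒Closed ∘ allClosed) x)
    where
    F≡F++[] : F ≡ F ++ []
    F≡F++[] = sym (++-identityʳ F)
  ... | inj₂ (_ , _ , (y , _ , y∉) , _) | zero = contradiction too-long λ ()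
    where
    too-long : 1 ≤ 0
    too-long = +-cancelˡ-≤ (length F) 1 0 (begin
      length F + 1        ≡⟨ sym (length-++ F) ⟩
      length (F ++ [ y ]) ≤⟨ Unique⇒length≤ (Unique-∷ʳ u y∉) ⟩
      n                   ≤⟨ bound ⟩
      length F + 0        ∎)
      where open ≤-Reasoning
  ... | inj₂ (w , w∈ , (y , w∼y , y∉) , later) | suc k = Completion-∷ʳ
    (complete conn k (subst (n ≤_) rounds bound) (Unique-∷ʳ u y∉)
      (DepthFirst-∷ʳ y∉ df w∈ w∼y λ x∈ w<x → ¬Open⇒Closed (later x∈ w<x)) (∈-++⁺ˡ v∈))
    where
    rounds : length F + suc k ≡ length (F ++ [ y ]) + k
    rounds = trans (sym (+-assoc (length F) 1 k)) (cong (_+ k) (sym (length-++ F)))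

  -- Kept opaque: unfolding the search in later proofs makes type checking very slow.
  opaque
    Path⇒DFS-prefix : Connected G → ∀ {P v} → v ∈ P → Unique P → Linked _∼_ P →
      ∃[ σ ] (IsDFS G σ × (∀ {x} → x ∈ P → rank σ x ≡ position x P) ×
              (∀ {x} → rank σ x < length P → x ∈ P))
    Path⇒DFS-prefix conn {P} v∈ u l
      with Q , uQ , df , all ← complete conn n (m≤n+m n (length P)) u (Linked⇒DepthFirst u l) v∈
      with σ , rank≡ ← enumeration⇒ordering uQ all
      = σ , DepthFirst⇒IsDFS σ rank≡ all df ,
        (λ {x} x∈ → trans (rank≡ x) (position-++ˡ Q x∈)) ,
        (λ {x} x<P → position-++<length⇒∈ P Q (subst (_< length P) (rank≡ x) x<P))

  ObstructingPath⇒¬LexDFS : Connected G → ObstructingPath _∼_ → ∃[ σ ] (IsDFS G σ × ¬ IsLexDFS G σ)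
  ObstructingPath⇒¬LexDFS conn O
    with σ , dfs , onPath , offPath
           ← Path⇒DFS-prefix conn (here refl) (ObstructingPath.unique O) (ObstructingPath.linked O)
    = σ , dfs , ¬lex
    where
    open ObstructingPath O
    rank-a : rank σ a ≡ 0
    rank-a = trans (onPath (here refl)) (position-here a path)
    rank-b : rank σ b ≡ suc (position b path)
    rank-b = trans (onPath (there b∈path))
      (position-there path (∈∧∉⇒≢ b∈path (Uniqueₚ.Unique[x∷xs]⇒x∉xs unique)))
    b<length : rank σ b < length (a ∷ path)
    b<length = subst (_< length (a ∷ path)) (sym (onPath (there b∈path))) (position<length (there b∈path))
    on-path⇒¬lex : ∀ {d} → d ∈ a ∷ path → a <[ σ ] d → d ∼ b → ¬ d ∼ c → ⊥
    on-path⇒¬lex (here d≡a) a<d _   _   = <-irrefl (cong (rank σ) (sym d≡a)) a<d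
    on-path⇒¬lex (there d∈) _   d∼b d≁c = d≁c (∼b⇒∼c d∈ d∼b)
    ¬lex : ¬ IsLexDFS G σ
    ¬lex lex =
      let a<b = subst₂ _<_ (sym rank-a) (sym rank-b) (s≤s z≤n)
          b<c = <-≤-trans b<length (≮⇒≥ (c∉path ∘ offPath))
          d , a<d , d<b , d∼b , d≁c = lex a b c a<b b<c a∼c a≁b
      in  on-path⇒¬lex (offPath (<-trans d<b b<length)) a<d d∼b d≁c

diamondObstruction : ObstructingPath DiamondAdj
diamondObstruction = record
  { a      = v₀
  ; b      = v₃
  ; c      = v₂
  ; path   = v₁ ∷ v₃ ∷ []
  ; unique = ((λ ()) ∷ (λ ()) ∷ []) ∷ ((λ ()) ∷ []) ∷ [] ∷ []
  ; linked = from-yes (diamond? v₀ v₁) ∷ from-yes (diamond? v₁ v₃) ∷ [-]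
  ; b∈path = there (here refl)
  ; c∉path = λ { (here ()) ; (there (here ())) ; (there (there (here ()))) }
  ; a∼c    = from-yes (diamond? v₀ v₂)
  ; a≁b    = from-no (diamond? v₀ v₃)
  ; ∼b⇒∼c  = λ where
      (here refl)         _     → from-yes (diamond? v₁ v₂)
      (there (here refl)) v₃∼v₃ → contradiction v₃∼v₃ (from-no (diamond? v₃ v₃))
  }
  where
  v₀ v₁ v₂ v₃ : Fin 4
  v₀ = Fin.zero
  v₁ = Fin.suc Fin.zero
  v₂ = Fin.suc (Fin.suc Fin.zero)
  v₃ = Fin.suc (Fin.suc (Fin.suc Fin.zero))
  diamond? : ∀ x y → Dec (DiamondAdj x y)
  diamond? x y = ¬? (toℕ x ≟ toℕ y)
           ×-dec ¬? ((toℕ x ≟ 0) ×-dec (toℕ y ≟ 3))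
           ×-dec ¬? ((toℕ x ≟ 3) ×-dec (toℕ y ≟ 0))

module Pan (k′ : ℕ) where

  k : ℕ
  k = 3 + k′

  -- PanAdj k x y unfolds to PanAdjℕ (toℕ x) (toℕ y).
  PanAdjℕ : ℕ → ℕ → Set
  PanAdjℕ x y = CycleAdjℕ k x y ⊎ (x ≡ k × y ≡ 0) ⊎ (x ≡ 0 × y ≡ k)

  pendant-neighbour : ∀ {x} → PanAdjℕ x k → x ≡ 0
  pendant-neighbour (inj₁ ((_ , k<k) , _)) = contradiction k<k (<-irrefl refl)
  pendant-neighbour (inj₂ (inj₁ (_ , ())))
  pendant-neighbour (inj₂ (inj₂ (x≡0 , _))) = x≡0

  -- The path 2, 3, …, k − 1, 0, k of the pan, indexed by 0, …, k − 1.
  labelBy : ∀ i → Tri (i < suc k′) (i ≡ suc k′) (i > suc k′) → ℕ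
  labelBy i (tri< _ _ _) = 2 + i
  labelBy i (tri≈ _ _ _) = 0
  labelBy i (tri> _ _ _) = k

  label : ℕ → ℕ
  label i = labelBy i (<-cmp i (suc k′))

  data Stage (i : ℕ) : Set where
    cycle   : i ≤ k′ → label i ≡ 2 + i → Stage i
    hub     : i ≡ suc k′ → label i ≡ 0 → Stage i
    pendant : i ≡ 2 + k′ → label i ≡ k → Stage i

  stage : ∀ {i} → i < k → Stage i
  stage {i} i<k with <-cmp i (suc k′) in eq
  ... | tri< i<1+k′ _ _ = cycle (s≤s⁻¹ i<1+k′) (cong (labelBy i) eq)
  ... | tri≈ _ i≡1+k′ _ = hub i≡1+k′ (cong (labelBy i) eq)
  ... | tri> _ _ 1+k′<i = pendant (≤-antisym (s≤s⁻¹ i<k) 1+k′<i) (cong (labelBy i) eq)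

  label<1+k : ∀ i → label i < suc k
  label<1+k i with <-cmp i (suc k′)
  ... | tri< i<1+k′ _ _ = s≤s (s≤s (m≤n⇒m≤1+n i<1+k′))
  ... | tri≈ _ _ _      = s≤s z≤n
  ... | tri> _ _ _      = n<1+n k

  label-injective : ∀ {i j} → i < k → j < k → label i ≡ label j → i ≡ j
  label-injective i<k j<k eq with stage i<k | stage j<k
  ... | cycle _ li     | cycle _ lj     = +-cancelˡ-≡ 2 _ _ (trans (sym li) (trans eq lj))
  ... | cycle _ li     | hub _ lj       = contradiction (trans (sym li) (trans eq lj)) λ ()
  ... | cycle i≤k′ li  | pendant _ lj   =
    contradiction (trans (sym li) (trans eq lj)) (<⇒≢ (s≤s (s≤s (s≤s i≤k′))))
  ... | hub _ li       | cycle _ lj     = contradiction (trans (sym lj) (trans (sym eq) li)) λ ()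
  ... | hub i≡ _       | hub j≡ _       = trans i≡ (sym j≡)
  ... | hub _ li       | pendant _ lj   = contradiction (trans (sym li) (trans eq lj)) λ ()
  ... | pendant _ li   | cycle j≤k′ lj  =
    contradiction (trans (sym lj) (trans (sym eq) li)) (<⇒≢ (s≤s (s≤s (s≤s j≤k′))))
  ... | pendant _ li   | hub _ lj       = contradiction (trans (sym lj) (trans (sym eq) li)) λ ()
  ... | pendant i≡ _   | pendant j≡ _   = trans i≡ (sym j≡)

  label-adjacent : ∀ {i} → suc i < k → PanAdjℕ (label i) (label (suc i))
  label-adjacent {i} 1+i<k with stage (<-trans (n<1+n i) 1+i<k) | stage 1+i<k
  ... | cycle _ li | cycle 1+i≤k′ l1+i = subst₂ PanAdjℕ (sym li) (sym l1+i)
    (inj₁ ((s≤s (s≤s (s≤s (<⇒≤ 1+i≤k′))) , s≤s (s≤s (s≤s 1+i≤k′))) , inj₁ refl))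
  ... | cycle _ li | hub 1+i≡ l1+i = subst₂ PanAdjℕ (sym li) (sym l1+i)
    (inj₁ ((s≤s (s≤s (s≤s (≤-reflexive (suc-injective 1+i≡)))) , s≤s z≤n) ,
      inj₂ (inj₂ (inj₂ (refl , cong (2 +_) 1+i≡)))))
  ... | cycle i≤k′ _ | pendant 1+i≡ _ = contradiction (subst (_≤ k′) (suc-injective 1+i≡) i≤k′) 1+n≰n
  ... | hub _ li | pendant _ l1+i = subst₂ PanAdjℕ (sym li) (sym l1+i) (inj₂ (inj₂ (refl , refl)))
  ... | hub i≡ _ | cycle 1+i≤k′ _ =
    contradiction (≤-trans (n≤1+n _) (subst (_≤ k′) (cong suc i≡) 1+i≤k′)) 1+n≰n
  ... | hub i≡ _ | hub 1+i≡ _ = contradiction (trans (sym (cong suc i≡)) 1+i≡) 1+n≢n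
  ... | pendant i≡ _ | _ = contradiction (subst (λ j → suc j < k) i≡ 1+i<k) (<-irrefl refl)

  label≢1 : ∀ {i} → i < k → label i ≢ 1
  label≢1 i<k with stage i<k
  ... | cycle _ li   = λ l≡1 → contradiction (trans (sym li) l≡1) λ ()
  ... | hub _ li     = λ l≡1 → contradiction (trans (sym li) l≡1) λ ()
  ... | pendant _ li = λ l≡1 → contradiction (trans (sym li) l≡1) λ ()

  label-start : label 0 ≡ 2
  label-start with stage {0} (s≤s z≤n)
  ... | cycle _ l0 = l0
  ... | hub () _
  ... | pendant () _

  label-end : label (2 + k′) ≡ k
  label-end with stage {2 + k′} ≤-refl
  ... | cycle 2+k′≤k′ _ = contradiction (≤-trans (n≤1+n _) 2+k′≤k′) 1+n≰n
  ... | hub 2+k′≡ _     = contradiction 2+k′≡ 1+n≢n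
  ... | pendant _ l     = l

  vertex : ℕ → Fin (suc k)
  vertex i = fromℕ< (label<1+k i)

  toℕ-vertex : ∀ i → toℕ (vertex i) ≡ label i
  toℕ-vertex i = toℕ-fromℕ< (label<1+k i)

  obstruction : ObstructingPath (PanAdj k)
  obstruction = record
    { a      = vertex 0
    ; b      = vertex (2 + k′)
    ; c      = Fin.suc Fin.zero
    ; path   = applyUpTo (vertex ∘ suc) (2 + k′)
    ; unique = Uniqueₚ.applyUpTo⁺₁ vertex k λ {i} {j} i<j j<k vi≡vj →
        <⇒≢ i<j (label-injective (<-trans i<j j<k) j<k
          (trans (sym (toℕ-vertex i)) (trans (cong toℕ vi≡vj) (toℕ-vertex j))))
    ; linked = Linkedₚ.applyUpTo⁺₁ vertex k λ {i} 1+i<k →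
        subst₂ PanAdjℕ (sym (toℕ-vertex i)) (sym (toℕ-vertex (suc i))) (label-adjacent 1+i<k)
    ; b∈path = ∈-applyUpTo⁺ (vertex ∘ suc) (n<1+n (suc k′))
    ; c∉path = λ c∈ → let i , i<k , c≡vi = ∈-applyUpTo⁻ vertex c∈ in
        label≢1 i<k (trans (sym (toℕ-vertex i)) (sym (cong toℕ c≡vi)))
    ; a∼c    = subst (λ x → PanAdjℕ x 1) (sym a-label)
        (inj₁ ((s≤s (s≤s (s≤s z≤n)) , s≤s (s≤s z≤n)) , inj₂ (inj₁ refl)))
    ; a≁b    = λ a∼b →
        contradiction (trans (sym a-label) (pendant-neighbour (subst (PanAdjℕ _) b-label a∼b))) λ ()
    ; ∼b⇒∼c  = λ _ d∼b →
        subst (λ x → PanAdjℕ x 1) (sym (pendant-neighbour (subst (PanAdjℕ _) b-label d∼b)))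
        (inj₁ ((s≤s z≤n , s≤s (s≤s z≤n)) , inj₁ refl))
    }
    where
    a-label : toℕ (vertex 0) ≡ 2
    a-label = trans (toℕ-vertex 0) label-start
    b-label : toℕ (vertex (2 + k′)) ≡ k
    b-label = trans (toℕ-vertex (2 + k′)) label-end

open DepthFirstSearch using (ObstructingPath⇒¬LexDFS)

lemma5 : {n : ℕ} (G : Graph n) → Connected G →
         ((Σ ℕ λ k → 3 ≤ k × InducedSub (PanAdj k) G) ⊎ InducedSub DiamondAdj G) →
         ∃[ σ ] (IsDFS G σ × ¬ IsLexDFS G σ)
lemma5 G conn (inj₁ (suc (suc (suc k′)) , _ , pan)) =
  ObstructingPath⇒¬LexDFS G conn (ObstructingPath-map {H = PanAdj _} {G = G} pan (Pan.obstruction k′))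
lemma5 G conn (inj₂ diamond) =
  ObstructingPath⇒¬LexDFS G conn (ObstructingPath-map {H = DiamondAdj} {G = G} diamond diamondObstruction)
lemma5 G conn (inj₁ (0 , () , _))
lemma5 G conn (inj₁ (1 , s≤s () , _))
lemma5 G conn (inj₁ (2 , s≤s (s≤s ()) , _))
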